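{- Let $p\ge7$ be a prime and let $C$ be a self-orthogonal code of length $k$ over $\mathbb{F}_p$. Then $L_A(C)(2)=R(2)$, where $R=A_{p-1}^k$.
   Context: A code of length $k$ over $\mathbb{F}_p$ is a subspace of $\mathbb{F}_p^k$; self-orthogonal means $C\subset C^\perp$ for the standard dot product. $A_{p-1}=\{x\in\mathbb{Z}^p:\sum x_i=0\}$ with the standard inner product, $\varepsilon_1=e_1-\frac1p\sum_je_j$, $A_{p-1}^*/A_{p-1}=\langle\varepsilon_1+A_{p-1}\rangle\cong\mathbb{Z}/p$. Identify $\mathbb{F}_p^k$ with $(A_{p-1}^*/A_{p-1})^k$ via $a\mapsto(a_i\varepsilon_1+A_{p-1})_i$; $L_A(C)$ is the preimage of $C$ in $(A_{p-1}^*)^k$, which contains $R=A_{p-1}^k$. For a lattice $L$, $L(2)=\{x\in L:(x,x)=2\}$. -}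

module Defs where

open import Data.Nat as ℕ using (ℕ; zero; suc; NonZero; _%_)
open import Data.Nat.Divisibility using (_∣_)
open import Data.Nat.DivMod using (_mod_)
open import Data.Integer as ℤ using (ℤ; +_)
open import Data.Rational as ℚ using (ℚ; 0ℚ; 1ℚ; _/_)
open import Data.Fin using (Fin; toℕ)
open import Data.Product using (Σ; _×_; ∃)
open import Relation.Binary.PropositionalEquality using (_≡_)
open import Relation.Nullary using (yes; no)

ℕsum : (n : ℕ) → (Fin n → ℕ) → ℕ
ℕsum zero    f = 0
ℕsum (suc n) f = f Data.Fin.zero ℕ.+ ℕsum n (λ i → f (Data.Fin.suc i))

ℤsum : (n : ℕ) → (Fin n → ℤ) → ℤ
ℤsum zero    f = + 0
ℤsum (suc n) f = f Data.Fin.zero ℤ.+ ℤsum n (λ i → f (Data.Fin.suc i))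

ℚsum : (n : ℕ) → (Fin n → ℚ) → ℚ
ℚsum zero    f = 0ℚ
ℚsum (suc n) f = f Data.Fin.zero ℚ.+ ℚsum n (λ i → f (Data.Fin.suc i))

module _ (p : ℕ) .{{_ : NonZero p}} where

  Word : ℕ → Set
  Word k = Fin k → Fin p

  _⊕_ : {k : ℕ} → Word k → Word k → Word k
  (x ⊕ y) i = (toℕ (x i) ℕ.+ toℕ (y i)) mod p

  _⊙_ : {k : ℕ} → Fin p → Word k → Word k
  (a ⊙ x) i = (toℕ a ℕ.* toℕ (x i)) mod p

  zeroWord : {k : ℕ} → Word k
  zeroWord i = 0 mod p

  Orth : {k : ℕ} → Word k → Word k → Set
  Orth {k} x y = p ∣ ℕsum k (λ i → toℕ (x i) ℕ.* toℕ (y i))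

  record IsCode (k : ℕ) (C : Word k → Set) : Set where
    field
      has-zero : C zeroWord
      closed-+ : ∀ x y → C x → C y → C (x ⊕ y)
      closed-· : ∀ a x → C x → C (a ⊙ x)

  SelfOrthogonal : (k : ℕ) → (Word k → Set) → Set
  SelfOrthogonal k C = ∀ x y → C x → C y → Orth x y

  ℚVec : Set
  ℚVec = Fin p → ℚ

  -- ε₁ = e₁ - (1/p) Σ_j e_j   (e₁ is the coordinate with index 0)
  ε₁ : ℚVec
  ε₁ j with toℕ j ℕ.≟ 0
  ... | yes _ = 1ℚ ℚ.- (+ 1 / p)
  ... | no  _ = 0ℚ ℚ.- (+ 1 / p)

  InA : ℚVec → Set
  InA x = Σ (Fin p → ℤ) λ a → (ℤsum p a ≡ + 0) × (∀ j → x j ≡ a j / 1)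

  _-ᵥ_ : ℚVec → ℚVec → ℚVec
  (x -ᵥ y) j = x j ℚ.- y j

  _·ᵥ_ : ℕ → ℚVec → ℚVec
  (n ·ᵥ x) j = (+ n / 1) ℚ.* x j

  InClass : Fin p → ℚVec → Set
  InClass c v = InA (v -ᵥ (toℕ c ·ᵥ ε₁))

  LVec : ℕ → Set
  LVec k = Fin k → ℚVec

  -- L_A(C): preimage of C under (A*)^k → (A*/A)^k ≅ F_p^k, a ↦ (a_i ε₁ + A)_i
  InLA : (k : ℕ) → (Word k → Set) → LVec k → Set
  InLA k C v = Σ (Word k) λ c → C c × (∀ i → InClass (c i) (v i))

  InR : (k : ℕ) → LVec k → Set
  InR k v = ∀ i → InA (v i)

  norm : (k : ℕ) → LVec k → ℚ
  norm k v = ℚsum k (λ i → ℚsum p (λ j → v i j ℚ.* v i j))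

  InL2 : (k : ℕ) → (LVec k → Set) → LVec k → Set
  InL2 k L v = L v × (norm k v ≡ + 2 / 1)

{-# OPTIONS --safe #-}
module Submission where

-- Write v ∈ L_A(C) blockwise, v_i ∈ c_i ε₁ + A_{p-1} with 0 ≤ c_i < p. Such a block is
-- b − (c_i/p)(1,…,1) with b ∈ ℤ^p and Σ b = c_i, so p (v_i, v_i) = p Σ b² − c_i², which is
-- c_i (p − c_i) + p t_i with t_i ≥ 0 because Σ b² ≥ Σ b. If (v, v) = 2, the total defect
-- E = Σ c_i (p − c_i) is therefore a multiple of p and at most 2p. A nonzero defect is prime
-- to p and is either p − 1 or at least 2(p − 2), so for p ≥ 7 no nonempty sum of defects is
-- a multiple of p below 2p: all c_i vanish and v ∈ R.

open import Defs
open import Data.Nat using (ℕ; NonZero; _≤_)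
open import Data.Nat.Primality using (Prime)
open import Data.Product using (_×_)

open import Data.Nat as ℕ using (zero; suc; _<_; _+_; _*_; _∸_)
import Data.Nat.Properties as ℕP
open import Data.Nat.DivMod using (_mod_)
open import Data.Nat.Divisibility using (_∣_; ∣m+n∣m⇒∣n; ∣⇒≤; m∣m*n; n∣m*n)
open import Data.Nat.Primality using (euclidsLemma)
open import Data.Nat.Tactic.RingSolver using () renaming (solve-∀ to ℕ-solve)
open import Data.Integer as ℤ using (ℤ; +_; +[1+_]; -[1+_])
import Data.Integer.Properties as ℤP
open import Data.Integer.Tactic.RingSolver using () renaming (solve-∀ to ℤ-solve)
open import Data.Rational as ℚ using (ℚ; 0ℚ; 1ℚ; _/_)
import Data.Rational.Properties as ℚP
import Data.Rational.Unnormalised as ℚᵘ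
import Data.Rational.Unnormalised.Properties as ℚᵘP
open import Data.Fin as Fin using (Fin; toℕ)
import Data.Fin.Properties as FinP
open import Data.Product using (Σ; _,_; proj₁; proj₂)
open import Data.Sum using (_⊎_; inj₁; inj₂)
open import Data.Empty using (⊥-elim)
open import Function using (_∘_; _⇔_; mk⇔; Equivalence)
open import Level using (0ℓ)
open import Relation.Nullary using (¬_; dec⇒maybe)
open import Relation.Binary.PropositionalEquality
open import Tactic.RingSolver using (solve-∀)
import Tactic.RingSolver.Core.AlmostCommutativeRing as ACR

ℚring : ACR.AlmostCommutativeRing 0ℓ 0ℓ
ℚring = ACR.fromCommutativeRing ℚP.+-*-commutativeRing (λ x → dec⇒maybe (0ℚ ℚP.≟ x))

ι : ℤ → ℚ
ι z = z / 1

toℚᵘ-ι : ∀ z → ℚ.toℚᵘ (ι z) ℚᵘ.≃ ℚᵘ.mkℚᵘ z 0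
toℚᵘ-ι z = ℚP.toℚᵘ-fromℚᵘ (ℚᵘ.mkℚᵘ z 0)

ι-+ : ∀ a b → ι (a ℤ.+ b) ≡ ι a ℚ.+ ι b
ι-+ a b = ℚP.toℚᵘ-injective (begin
  ℚ.toℚᵘ (ι (a ℤ.+ b))                ≈⟨ toℚᵘ-ι (a ℤ.+ b) ⟩
  ℚᵘ.mkℚᵘ (a ℤ.+ b) 0                 ≈⟨ ℚᵘ.*≡* (sum-identity a b) ⟩
  ℚᵘ.mkℚᵘ a 0 ℚᵘ.+ ℚᵘ.mkℚᵘ b 0        ≈⟨ ℚᵘP.+-cong (toℚᵘ-ι a) (toℚᵘ-ι b) ⟨
  ℚ.toℚᵘ (ι a) ℚᵘ.+ ℚ.toℚᵘ (ι b)      ≈⟨ ℚP.toℚᵘ-homo-+ (ι a) (ι b) ⟨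
  ℚ.toℚᵘ (ι a ℚ.+ ι b)                ∎)
  where
  open ℚᵘP.≃-Reasoning
  sum-identity : ∀ a b → (a ℤ.+ b) ℤ.* + 1 ≡ (a ℤ.* + 1 ℤ.+ b ℤ.* + 1) ℤ.* + 1
  sum-identity = ℤ-solve

ι-* : ∀ a b → ι (a ℤ.* b) ≡ ι a ℚ.* ι b
ι-* a b = ℚP.toℚᵘ-injective (begin
  ℚ.toℚᵘ (ι (a ℤ.* b))                ≈⟨ toℚᵘ-ι (a ℤ.* b) ⟩
  ℚᵘ.mkℚᵘ a 0 ℚᵘ.* ℚᵘ.mkℚᵘ b 0        ≈⟨ ℚᵘP.*-cong (toℚᵘ-ι a) (toℚᵘ-ι b) ⟨
  ℚ.toℚᵘ (ι a) ℚᵘ.* ℚ.toℚᵘ (ι b)      ≈⟨ ℚP.toℚᵘ-homo-* (ι a) (ι b) ⟨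
  ℚ.toℚᵘ (ι a ℚ.* ι b)                ∎)
  where open ℚᵘP.≃-Reasoning

ι-neg : ∀ a → ι (ℤ.- a) ≡ ℚ.- ι a
ι-neg a = ℚP.toℚᵘ-injective (begin
  ℚ.toℚᵘ (ι (ℤ.- a))     ≈⟨ toℚᵘ-ι (ℤ.- a) ⟩
  ℚᵘ.- ℚᵘ.mkℚᵘ a 0       ≈⟨ ℚᵘP.-‿cong (toℚᵘ-ι a) ⟨
  ℚᵘ.- ℚ.toℚᵘ (ι a)      ≈⟨ ℚP.toℚᵘ-homo‿- (ι a) ⟨
  ℚ.toℚᵘ (ℚ.- ι a)       ∎)
  where open ℚᵘP.≃-Reasoning

ι-- : ∀ a b → ι (a ℤ.- b) ≡ ι a ℚ.- ι b
ι-- a b = trans (ι-+ a (ℤ.- b)) (cong (ι a ℚ.+_) (ι-neg b))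

ι-injective : ∀ {a b} → ι a ≡ ι b → a ≡ b
ι-injective {a} {b} ιa≡ιb with ℚP./-injective-≃ (ℚᵘ.mkℚᵘ a 0) (ℚᵘ.mkℚᵘ b 0) ιa≡ιb
... | ℚᵘ.*≡* a*1≡b*1 = trans (sym (ℤP.*-identityʳ a)) (trans a*1≡b*1 (ℤP.*-identityʳ b))

ι[p]*1/p≡1 : ∀ p .{{_ : NonZero p}} → ι (+ p) ℚ.* (+ 1 / p) ≡ 1ℚ
ι[p]*1/p≡1 p@(suc p-1) = ℚP.toℚᵘ-injective (begin
  ℚ.toℚᵘ (ι (+ p) ℚ.* u)                 ≈⟨ ℚP.toℚᵘ-homo-* (ι (+ p)) u ⟩
  ℚ.toℚᵘ (ι (+ p)) ℚᵘ.* ℚ.toℚᵘ u         ≈⟨ ℚᵘP.*-cong (toℚᵘ-ι (+ p)) toℚᵘ-u ⟩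
  ℚᵘ.mkℚᵘ (+ p) 0 ℚᵘ.* ℚᵘ.mkℚᵘ (+ 1) p-1 ≈⟨ ℚᵘ.*≡* (cancel (+ p)) ⟩
  ℚ.toℚᵘ 1ℚ                              ∎)
  where
  open ℚᵘP.≃-Reasoning
  u = + 1 / p
  toℚᵘ-u = ℚP.toℚᵘ-fromℚᵘ (ℚᵘ.mkℚᵘ (+ 1) p-1)
  cancel : ∀ q → (q ℤ.* + 1) ℤ.* + 1 ≡ + 1 ℤ.* (+ 1 ℤ.* q)
  cancel = ℤ-solve

ℚsum-cong : ∀ n {f g : Fin n → ℚ} → (∀ i → f i ≡ g i) → ℚsum n f ≡ ℚsum n g
ℚsum-cong zero    f≗g = refl
ℚsum-cong (suc n) f≗g = cong₂ ℚ._+_ (f≗g Fin.zero) (ℚsum-cong n (f≗g ∘ Fin.suc))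

ℚsum-ι : ∀ n (f : Fin n → ℤ) → ℚsum n (ι ∘ f) ≡ ι (ℤsum n f)
ℚsum-ι zero    f = refl
ℚsum-ι (suc n) f = trans (cong (ι (f Fin.zero) ℚ.+_) (ℚsum-ι n (f ∘ Fin.suc)))
                         (sym (ι-+ (f Fin.zero) (ℤsum n (f ∘ Fin.suc))))

*-distribˡ-ℚsum : ∀ n x (f : Fin n → ℚ) → x ℚ.* ℚsum n f ≡ ℚsum n (λ i → x ℚ.* f i)
*-distribˡ-ℚsum zero    x f = ℚP.*-zeroʳ x
*-distribˡ-ℚsum (suc n) x f =
  trans (ℚP.*-distribˡ-+ x _ _) (cong (x ℚ.* f Fin.zero ℚ.+_) (*-distribˡ-ℚsum n x (f ∘ Fin.suc)))

ℚsum-[f-K]² : ∀ m (f : Fin m → ℚ) K →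
  ℚsum m (λ j → (f j ℚ.- K) ℚ.* (f j ℚ.- K)) ≡
  ℚsum m (λ j → f j ℚ.* f j) ℚ.- (K ℚ.+ K) ℚ.* ℚsum m f ℚ.+ ι (+ m) ℚ.* (K ℚ.* K)
ℚsum-[f-K]² zero    f K = base K
  where
  base : ∀ K → 0ℚ ≡ 0ℚ ℚ.- (K ℚ.+ K) ℚ.* 0ℚ ℚ.+ 0ℚ ℚ.* (K ℚ.* K)
  base = solve-∀ ℚring
ℚsum-[f-K]² (suc m) f K = begin
  (x ℚ.- K) ℚ.* (x ℚ.- K) ℚ.+ ℚsum m (λ j → (f′ j ℚ.- K) ℚ.* (f′ j ℚ.- K))
    ≡⟨ cong ((x ℚ.- K) ℚ.* (x ℚ.- K) ℚ.+_) (ℚsum-[f-K]² m f′ K) ⟩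
  (x ℚ.- K) ℚ.* (x ℚ.- K) ℚ.+ (A ℚ.- (K ℚ.+ K) ℚ.* B ℚ.+ ι (+ m) ℚ.* (K ℚ.* K))
    ≡⟨ step x A B (ι (+ m)) K ⟩
  (x ℚ.* x ℚ.+ A) ℚ.- (K ℚ.+ K) ℚ.* (x ℚ.+ B) ℚ.+ (1ℚ ℚ.+ ι (+ m)) ℚ.* (K ℚ.* K)
    ≡⟨ cong (λ y → (x ℚ.* x ℚ.+ A) ℚ.- (K ℚ.+ K) ℚ.* (x ℚ.+ B) ℚ.+ y ℚ.* (K ℚ.* K)) (ι-+ (+ 1) (+ m)) ⟨
  (x ℚ.* x ℚ.+ A) ℚ.- (K ℚ.+ K) ℚ.* (x ℚ.+ B) ℚ.+ ι (+ suc m) ℚ.* (K ℚ.* K) ∎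
  where
  open ≡-Reasoning
  x = f Fin.zero
  f′ = f ∘ Fin.suc
  A = ℚsum m (λ j → f′ j ℚ.* f′ j)
  B = ℚsum m f′
  step : ∀ x A B M K →
    (x ℚ.- K) ℚ.* (x ℚ.- K) ℚ.+ (A ℚ.- (K ℚ.+ K) ℚ.* B ℚ.+ M ℚ.* (K ℚ.* K)) ≡
    (x ℚ.* x ℚ.+ A) ℚ.- (K ℚ.+ K) ℚ.* (x ℚ.+ B) ℚ.+ (1ℚ ℚ.+ M) ℚ.* (K ℚ.* K)
  step = solve-∀ ℚring

ℤsum-pos : ∀ n (f : Fin n → ℕ) → ℤsum n (+_ ∘ f) ≡ + ℕsum n f
ℤsum-pos zero    f = refl
ℤsum-pos (suc n) f = cong (ℤ._+_ (+ f Fin.zero)) (ℤsum-pos n (f ∘ Fin.suc))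

ℤsum-mono-≤ : ∀ n {f g : Fin n → ℤ} → (∀ i → f i ℤ.≤ g i) → ℤsum n f ℤ.≤ ℤsum n g
ℤsum-mono-≤ zero    f≤g = ℤP.≤-refl
ℤsum-mono-≤ (suc n) f≤g = ℤP.+-mono-≤ (f≤g Fin.zero) (ℤsum-mono-≤ n (f≤g ∘ Fin.suc))

ℕsum-distrib-+ : ∀ n (f g : Fin n → ℕ) → ℕsum n (λ i → f i + g i) ≡ ℕsum n f + ℕsum n g
ℕsum-distrib-+ zero    f g = refl
ℕsum-distrib-+ (suc n) f g =
  trans (cong (_+_ (f Fin.zero + g Fin.zero)) (ℕsum-distrib-+ n (f ∘ Fin.suc) (g ∘ Fin.suc)))
        (interchange (f Fin.zero) (g Fin.zero) _ _)
  where
  interchange : ∀ a b c d → a + b + (c + d) ≡ a + c + (b + d)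
  interchange = ℕ-solve

*-distribˡ-ℕsum : ∀ n x (f : Fin n → ℕ) → ℕsum n (λ i → x * f i) ≡ x * ℕsum n f
*-distribˡ-ℕsum zero    x f = sym (ℕP.*-zeroʳ x)
*-distribˡ-ℕsum (suc n) x f =
  trans (cong (_+_ (x * f Fin.zero)) (*-distribˡ-ℕsum n x (f ∘ Fin.suc)))
        (sym (ℕP.*-distribˡ-+ x _ _))

ℕsum≡0⇒≡0 : ∀ n (f : Fin n → ℕ) → ℕsum n f ≡ 0 → ∀ i → f i ≡ 0
ℕsum≡0⇒≡0 (suc n) f Σf≡0 Fin.zero    = ℕP.m+n≡0⇒m≡0 (f Fin.zero) Σf≡0
ℕsum≡0⇒≡0 (suc n) f Σf≡0 (Fin.suc i) =
  ℕsum≡0⇒≡0 n (f ∘ Fin.suc) (ℕP.m+n≡0⇒n≡0 (f Fin.zero) Σf≡0) i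

-- Norms in the cosets c ε₁ + A_{p-1}

i≤i*i : ∀ i → i ℤ.≤ i ℤ.* i
i≤i*i (+ zero) = ℤP.≤-refl
i≤i*i +[1+ m ] = ℤ.+≤+ (ℕP.m≤m*n (suc m) (suc m))
i≤i*i -[1+ m ] = ℤ.-≤+

sqnorm : (p : ℕ) → (Fin p → ℚ) → ℚ
sqnorm p x = ℚsum p (λ j → x j ℚ.* x j)

InA-cong : ∀ p .{{_ : NonZero p}} {x y : ℚVec p} → (∀ j → x j ≡ y j) → InA p x → InA p y
InA-cong p x≗y (a , Σa≡0 , x≡a) = a , Σa≡0 , λ j → trans (sym (x≗y j)) (x≡a j)

InClass-zero⇔InA : ∀ p .{{_ : NonZero p}} {c : Fin p} {v : ℚVec p} →
  toℕ c ≡ 0 → InClass p c v ⇔ InA p v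
InClass-zero⇔InA p {c} {v} c≡0 =
  mk⇔ (InA-cong p shift-by-zero) (InA-cong p (sym ∘ shift-by-zero))
  where
  drop-zero : ∀ x y → x ℚ.- 0ℚ ℚ.* y ≡ x
  drop-zero = solve-∀ ℚring
  shift-by-zero : ∀ j → v j ℚ.- (+ toℕ c / 1) ℚ.* ε₁ p j ≡ v j
  shift-by-zero j rewrite c≡0 = drop-zero (v j) (ε₁ p j)

coset-representative : ∀ p .{{_ : NonZero p}} (c : Fin p) (v : ℚVec p) → InClass p c v →
  Σ (Fin p → ℤ) λ b → (ℤsum p b ≡ + toℕ c) ×
                      (∀ j → v j ≡ ι (b j) ℚ.- ι (+ toℕ c) ℚ.* (+ 1 / p))
coset-representative (suc p-1) c v (a , Σa≡0 , v≡a) = b , Σb≡n , v≡b-K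
  where
  n = toℕ c
  N = ι (+ n)
  u = + 1 / suc p-1
  b : Fin (suc p-1) → ℤ
  b Fin.zero    = a Fin.zero ℤ.+ + n
  b (Fin.suc j) = a (Fin.suc j)
  Σb≡n : ℤsum (suc p-1) b ≡ + n
  Σb≡n = begin
    a Fin.zero ℤ.+ + n ℤ.+ ℤsum p-1 (a ∘ Fin.suc) ≡⟨ swap (a Fin.zero) (+ n) _ ⟩
    ℤsum (suc p-1) a ℤ.+ + n                      ≡⟨ cong (ℤ._+ + n) Σa≡0 ⟩
    + n                                           ∎
    where
    open ≡-Reasoning
    swap : ∀ x y z → x ℤ.+ y ℤ.+ z ≡ x ℤ.+ z ℤ.+ y
    swap = ℤ-solve
  v≡b-K : ∀ j → v j ≡ ι (b j) ℚ.- N ℚ.* u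
  v≡b-K Fin.zero = begin
    v Fin.zero
      ≡⟨ split₀ (v Fin.zero) N u ⟩
    (v Fin.zero ℚ.- N ℚ.* (1ℚ ℚ.- u)) ℚ.+ N ℚ.- N ℚ.* u
      ≡⟨ cong (λ x → x ℚ.+ N ℚ.- N ℚ.* u) (v≡a Fin.zero) ⟩
    ι (a Fin.zero) ℚ.+ N ℚ.- N ℚ.* u
      ≡⟨ cong (ℚ._- N ℚ.* u) (ι-+ (a Fin.zero) (+ n)) ⟨
    ι (b Fin.zero) ℚ.- N ℚ.* u ∎
    where
    open ≡-Reasoning
    split₀ : ∀ x N u → x ≡ (x ℚ.- N ℚ.* (1ℚ ℚ.- u)) ℚ.+ N ℚ.- N ℚ.* u
    split₀ = solve-∀ ℚring
  v≡b-K (Fin.suc j) =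
    trans (split (v (Fin.suc j)) N u) (cong (ℚ._- N ℚ.* u) (v≡a (Fin.suc j)))
    where
    split : ∀ x N u → x ≡ (x ℚ.- N ℚ.* (0ℚ ℚ.- u)) ℚ.- N ℚ.* u
    split = solve-∀ ℚring

p‖b-n/p‖²≡pΣb²-n² : ∀ p .{{_ : NonZero p}} n (b : Fin p → ℤ) → ℤsum p b ≡ + n →
  let K = ι (+ n) ℚ.* (+ 1 / p) in
  ι (+ p) ℚ.* ℚsum p (λ j → (ι (b j) ℚ.- K) ℚ.* (ι (b j) ℚ.- K)) ≡
  ι (+ p ℤ.* ℤsum p (λ j → b j ℤ.* b j) ℤ.- + n ℤ.* + n)
p‖b-n/p‖²≡pΣb²-n² p n b Σb≡n = begin
  P ℚ.* ℚsum p (λ j → (ι (b j) ℚ.- K) ℚ.* (ι (b j) ℚ.- K))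
    ≡⟨ cong (P ℚ.*_) (ℚsum-[f-K]² p (ι ∘ b) K) ⟩
  P ℚ.* (ℚsum p (λ j → ι (b j) ℚ.* ι (b j)) ℚ.- (K ℚ.+ K) ℚ.* ℚsum p (ι ∘ b)
         ℚ.+ P ℚ.* (K ℚ.* K))
    ≡⟨ cong₂ (λ x y → P ℚ.* (x ℚ.- (K ℚ.+ K) ℚ.* y ℚ.+ P ℚ.* (K ℚ.* K))) Σb²≡S Σb≡N ⟩
  P ℚ.* (ι S ℚ.- (K ℚ.+ K) ℚ.* N ℚ.+ P ℚ.* (K ℚ.* K))
    ≡⟨ expand P (ι S) N K ⟩
  P ℚ.* ι S ℚ.- (P ℚ.* K ℚ.+ P ℚ.* K) ℚ.* N ℚ.+ (P ℚ.* K) ℚ.* (P ℚ.* K)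
    ≡⟨ cong (λ x → P ℚ.* ι S ℚ.- (x ℚ.+ x) ℚ.* N ℚ.+ x ℚ.* x) PK≡N ⟩
  P ℚ.* ι S ℚ.- (N ℚ.+ N) ℚ.* N ℚ.+ N ℚ.* N
    ≡⟨ collapse (P ℚ.* ι S) N ⟩
  P ℚ.* ι S ℚ.- N ℚ.* N
    ≡⟨ cong₂ ℚ._-_ (ι-* (+ p) S) (ι-* (+ n) (+ n)) ⟨
  ι (+ p ℤ.* S) ℚ.- ι (+ n ℤ.* + n)
    ≡⟨ ι-- (+ p ℤ.* S) (+ n ℤ.* + n) ⟨
  ι (+ p ℤ.* S ℤ.- + n ℤ.* + n) ∎
  where
  open ≡-Reasoning
  P = ι (+ p)
  N = ι (+ n)
  K = N ℚ.* (+ 1 / p)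
  S = ℤsum p (λ j → b j ℤ.* b j)
  Σb²≡S : ℚsum p (λ j → ι (b j) ℚ.* ι (b j)) ≡ ι S
  Σb²≡S = trans (ℚsum-cong p (λ j → sym (ι-* (b j) (b j)))) (ℚsum-ι p (λ j → b j ℤ.* b j))
  Σb≡N : ℚsum p (ι ∘ b) ≡ N
  Σb≡N = trans (ℚsum-ι p b) (cong ι Σb≡n)
  rearrange : ∀ P N u → P ℚ.* (N ℚ.* u) ≡ N ℚ.* (P ℚ.* u)
  rearrange = solve-∀ ℚring
  PK≡N : P ℚ.* K ≡ N
  PK≡N = trans (rearrange P N (+ 1 / p))
               (trans (cong (N ℚ.*_) (ι[p]*1/p≡1 p)) (ℚP.*-identityʳ N))
  expand : ∀ P S N K → P ℚ.* (S ℚ.- (K ℚ.+ K) ℚ.* N ℚ.+ P ℚ.* (K ℚ.* K)) ≡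
                       P ℚ.* S ℚ.- (P ℚ.* K ℚ.+ P ℚ.* K) ℚ.* N ℚ.+ (P ℚ.* K) ℚ.* (P ℚ.* K)
  expand = solve-∀ ℚring
  collapse : ∀ X N → X ℚ.- (N ℚ.+ N) ℚ.* N ℚ.+ N ℚ.* N ≡ X ℚ.- N ℚ.* N
  collapse = solve-∀ ℚring

pS-n²≡nd+p∣n-S∣ : ∀ n d {p} → n + d ≡ p → ∀ S → + n ℤ.≤ S →
  + p ℤ.* S ℤ.- + n ℤ.* + n ≡ + (n * d + p * ℤ.∣ + n ℤ.- S ∣)
pS-n²≡nd+p∣n-S∣ n d refl S n≤S = begin
  + (n + d) ℤ.* S ℤ.- + n ℤ.* + n
    ≡⟨ regroup (+ n) (+ d) S ⟩
  + n ℤ.* + d ℤ.+ + (n + d) ℤ.* (S ℤ.- + n)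
    ≡⟨ cong (λ t → + n ℤ.* + d ℤ.+ + (n + d) ℤ.* t) (ℤP.∣-∣-≤ n≤S) ⟨
  + n ℤ.* + d ℤ.+ + (n + d) ℤ.* + ℤ.∣ + n ℤ.- S ∣
    ≡⟨ cong₂ ℤ._+_ (ℤP.pos-* n d) (ℤP.pos-* (n + d) _) ⟨
  + (n * d + (n + d) * ℤ.∣ + n ℤ.- S ∣) ∎
  where
  open ≡-Reasoning
  regroup : ∀ N D S → (N ℤ.+ D) ℤ.* S ℤ.- N ℤ.* N ≡ N ℤ.* D ℤ.+ (N ℤ.+ D) ℤ.* (S ℤ.- N)
  regroup = ℤ-solve

coset-norm : ∀ p .{{_ : NonZero p}} (c : Fin p) d → toℕ c + d ≡ p →
  (v : ℚVec p) → InClass p c v → Σ ℕ λ t → ι (+ p) ℚ.* sqnorm p v ≡ ι (+ (toℕ c * d + p * t))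
coset-norm p c d n+d≡p v v∈c with coset-representative p c v v∈c
... | b , Σb≡n , v≡b-K = ℤ.∣ + n ℤ.- S ∣ , (begin
  ι (+ p) ℚ.* sqnorm p v
    ≡⟨ cong (ι (+ p) ℚ.*_) (ℚsum-cong p (λ j → cong₂ ℚ._*_ (v≡b-K j) (v≡b-K j))) ⟩
  ι (+ p) ℚ.* ℚsum p (λ j → (ι (b j) ℚ.- K) ℚ.* (ι (b j) ℚ.- K))
    ≡⟨ p‖b-n/p‖²≡pΣb²-n² p n b Σb≡n ⟩
  ι (+ p ℤ.* S ℤ.- + n ℤ.* + n)
    ≡⟨ cong ι (pS-n²≡nd+p∣n-S∣ n d n+d≡p S n≤S) ⟩
  ι (+ (n * d + p * ℤ.∣ + n ℤ.- S ∣)) ∎)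
  where
  open ≡-Reasoning
  n = toℕ c
  K = ι (+ n) ℚ.* (+ 1 / p)
  S = ℤsum p (λ j → b j ℤ.* b j)
  n≤S : + n ℤ.≤ S
  n≤S = subst (ℤ._≤ S) Σb≡n (ℤsum-mono-≤ p (λ j → i≤i*i (b j)))

-- The defect c (p − c), 0 < c < p, is p times the minimal norm of the coset c ε₁ + A_{p-1}.
data Defect (p : ℕ) : ℕ → Set where
  defect : ∀ a b → suc a + suc b ≡ p → Defect p (suc a * suc b)

defect-or-zero : ∀ {p} c d → c + d ≡ p → c * d ≡ 0 ⊎ Defect p (c * d)
defect-or-zero zero    d       _   = inj₁ refl
defect-or-zero (suc a) zero    _   = inj₁ (ℕP.*-zeroʳ (suc a))
defect-or-zero (suc a) (suc b) c+d≡p = inj₂ (defect a b c+d≡p)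

defect-≥ : ∀ {p e} → Defect p e → p ≤ suc e
defect-≥ (defect a b refl) =
  ℕP.≤-trans (ℕP.m≤m+n (suc a + suc b) (a * b)) (ℕP.≤-reflexive (identity a b))
  where
  identity : ∀ a b → suc a + suc b + a * b ≡ suc (suc a * suc b)
  identity = ℕ-solve

defect-minimal⊎large : ∀ {p e} → Defect p e → suc e ≡ p ⊎ 2 * p ≤ e + 4
defect-minimal⊎large (defect zero    b       refl) = inj₁ (minimal b)
  where
  minimal : ∀ b → suc (1 * suc b) ≡ 1 + suc b
  minimal = ℕ-solve
defect-minimal⊎large (defect (suc a) zero    refl) = inj₁ (minimal a)
  where
  minimal : ∀ a → suc (suc (suc a) * 1) ≡ suc (suc a) + 1
  minimal = ℕ-solve
defect-minimal⊎large (defect (suc a) (suc b) refl) =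
  inj₂ (ℕP.≤-trans (ℕP.m≤m+n _ (a * b)) (ℕP.≤-reflexive (identity a b)))
  where
  identity : ∀ a b → 2 * (suc (suc a) + suc (suc b)) + a * b ≡ suc (suc a) * suc (suc b) + 4
  identity = ℕ-solve

prime⇒∤defect : ∀ {p e} → Prime p → Defect p e → ¬ p ∣ e
prime⇒∤defect pr (defect a b refl) p∣e with euclidsLemma (suc a) (suc b) pr p∣e
... | inj₁ p∣a = ℕP.<⇒≱ (ℕP.m<m+n (suc a) ℕ.z<s) (∣⇒≤ p∣a)
... | inj₂ p∣b = ℕP.<⇒≱ (ℕP.m<n+m (suc b) ℕ.z<s) (∣⇒≤ p∣b)

-- The minimal defect is p − 1 and the next one is 2(p − 2), so for p ≥ 6 a sum of defects
-- that stays ≤ 2p is empty, a single defect, or two minimal ones.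
data DefectSum (p : ℕ) : ℕ → Set where
  none        : DefectSum p 0
  single      : ∀ {e} → Defect p e → DefectSum p e
  two-minimal : ∀ {e} → e + 2 ≡ 2 * p → DefectSum p e
  large       : ∀ {e} → 2 * p < e → DefectSum p e

sum-exceeds-2p : ∀ {p e E} → 6 ≤ p → p ≤ suc e → 2 * p ≤ E + 4 → 2 * p < e + E
sum-exceeds-2p {p} {e} {E} 6≤p p≤1+e 2p≤E+4 =
  ℕP.+-cancelʳ-≤ 5 (suc (2 * p)) (e + E) (begin
  suc (2 * p) + 5   ≡⟨ ℕP.+-suc (2 * p) 5 ⟨
  2 * p + 6         ≤⟨ ℕP.+-monoʳ-≤ (2 * p) 6≤p ⟩
  2 * p + p         ≤⟨ ℕP.+-mono-≤ 2p≤E+4 p≤1+e ⟩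
  E + 4 + suc e     ≡⟨ regroup E e ⟩
  e + E + 5         ∎)
  where
  open ℕP.≤-Reasoning
  regroup : ∀ E e → E + 4 + suc e ≡ e + E + 5
  regroup = ℕ-solve

DefectSum-+ : ∀ {p e E} → 6 ≤ p → Defect p e → DefectSum p E → DefectSum p (e + E)
DefectSum-+ {e = e} 6≤p δ none = single (subst (Defect _) (sym (ℕP.+-identityʳ e)) δ)
DefectSum-+ {p} {e} {E} 6≤p δ (single δ′) with defect-minimal⊎large δ | defect-minimal⊎large δ′
... | inj₁ 1+e≡p   | inj₁ 1+E≡p =
  two-minimal (trans (regroup e E) (cong₂ (λ x y → x + (y + 0)) 1+e≡p 1+E≡p))
  where
  regroup : ∀ e E → e + E + 2 ≡ suc e + (suc E + 0)
  regroup = ℕ-solve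
... | inj₁ _       | inj₂ E-large = large (sum-exceeds-2p 6≤p (defect-≥ δ) E-large)
... | inj₂ e-large | _            =
  large (subst (2 * p <_) (ℕP.+-comm E e) (sum-exceeds-2p 6≤p (defect-≥ δ′) e-large))
DefectSum-+ {E = E} 6≤p δ (two-minimal E+2≡2p) = large (sum-exceeds-2p 6≤p (defect-≥ δ) 2p≤E+4)
  where
  2p≤E+4 = ℕP.≤-trans (ℕP.≤-reflexive (sym E+2≡2p)) (ℕP.+-monoʳ-≤ E (ℕP.m≤m+n 2 2))
DefectSum-+ {e = e} 6≤p δ (large 2p<E) = large (ℕP.<-≤-trans 2p<E (ℕP.m≤n+m _ e))

DefectSum-ℕsum : ∀ {p} → 6 ≤ p → ∀ k (c d : Fin k → ℕ) → (∀ i → c i + d i ≡ p) →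
  DefectSum p (ℕsum k (λ i → c i * d i))
DefectSum-ℕsum 6≤p zero    c d c+d≡p = none
DefectSum-ℕsum 6≤p (suc k) c d c+d≡p
  with defect-or-zero (c Fin.zero) (d Fin.zero) (c+d≡p Fin.zero)
     | DefectSum-ℕsum 6≤p k (c ∘ Fin.suc) (d ∘ Fin.suc) (c+d≡p ∘ Fin.suc)
... | inj₁ cd≡0 | rest rewrite cd≡0 = rest
... | inj₂ δ    | rest = DefectSum-+ 6≤p δ rest

DefectSum-divisible⇒0 : ∀ {p E} → Prime p → 3 ≤ p → DefectSum p E →
  p ∣ E → E ≤ 2 * p → E ≡ 0
DefectSum-divisible⇒0 pr 3≤p none             p∣E E≤2p = refl
DefectSum-divisible⇒0 pr 3≤p (single δ)       p∣E E≤2p = ⊥-elim (prime⇒∤defect pr δ p∣E)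
DefectSum-divisible⇒0 {p} pr 3≤p (two-minimal eq) p∣E E≤2p =
  ⊥-elim (ℕP.<⇒≱ 3≤p (∣⇒≤ (∣m+n∣m⇒∣n (subst (p ∣_) (sym eq) (n∣m*n 2)) p∣E)))
DefectSum-divisible⇒0 pr 3≤p (large 2p<E)     p∣E E≤2p = ⊥-elim (ℕP.<⇒≱ 2p<E E≤2p)

defects-vanish : ∀ {p} → Prime p → 7 ≤ p → ∀ k (c d t : Fin k → ℕ) →
  (∀ i → c i + d i ≡ p) → ℕsum k (λ i → c i * d i + p * t i) ≡ 2 * p → ∀ i → c i * d i ≡ 0
defects-vanish {p} pr 7≤p k c d t c+d≡p total = ℕsum≡0⇒≡0 k (λ i → c i * d i) E≡0
  where
  E = ℕsum k (λ i → c i * d i)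
  E+pT≡2p : E + p * ℕsum k t ≡ 2 * p
  E+pT≡2p = trans (cong (_+_ E) (sym (*-distribˡ-ℕsum k p t)))
                  (trans (sym (ℕsum-distrib-+ k (λ i → c i * d i) (λ i → p * t i))) total)
  p∣E : p ∣ E
  p∣E = ∣m+n∣m⇒∣n (subst (p ∣_) (trans (sym E+pT≡2p) (ℕP.+-comm E _)) (n∣m*n 2))
                   (m∣m*n (ℕsum k t))
  E≡0 : E ≡ 0
  E≡0 = DefectSum-divisible⇒0 pr (ℕP.≤-trans (ℕP.m≤n+m 3 4) 7≤p)
          (DefectSum-ℕsum (ℕP.<⇒≤ 7≤p) k c d c+d≡p) p∣E
          (ℕP.≤-trans (ℕP.m≤m+n E _) (ℕP.≤-reflexive E+pT≡2p))

-- Vectors of norm 2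

norm≡2⇒ℕsum≡2p : ∀ p .{{_ : NonZero p}} k (v : LVec p k) (X : Fin k → ℕ) →
  (∀ i → ι (+ p) ℚ.* sqnorm p (v i) ≡ ι (+ X i)) → norm p k v ≡ ι (+ 2) → ℕsum k X ≡ 2 * p
norm≡2⇒ℕsum≡2p p k v X pv≡X ‖v‖≡2 = ℤP.+-injective (ι-injective (begin
  ι (+ ℕsum k X)                       ≡⟨ cong ι (ℤsum-pos k X) ⟨
  ι (ℤsum k (+_ ∘ X))                  ≡⟨ ℚsum-ι k (+_ ∘ X) ⟨
  ℚsum k (λ i → ι (+ X i))             ≡⟨ ℚsum-cong k pv≡X ⟨
  ℚsum k (λ i → P ℚ.* sqnorm p (v i))  ≡⟨ *-distribˡ-ℚsum k P (sqnorm p ∘ v) ⟨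
  P ℚ.* norm p k v                     ≡⟨ cong (P ℚ.*_) ‖v‖≡2 ⟩
  P ℚ.* ι (+ 2)                        ≡⟨ ℚP.*-comm P (ι (+ 2)) ⟩
  ι (+ 2) ℚ.* P                        ≡⟨ ι-* (+ 2) (+ p) ⟨
  ι (+ 2 ℤ.* + p)                      ≡⟨ cong ι (ℤP.pos-* 2 p) ⟨
  ι (+ (2 * p))                        ∎))
  where
  open ≡-Reasoning
  P = ι (+ p)

LA[2]⊆R[2] : ∀ p .{{_ : NonZero p}} → Prime p → 7 ≤ p → ∀ k (C : Word p k → Set) v →
  InL2 p k (InLA p k C) v → InL2 p k (InR p k) v
LA[2]⊆R[2] p pr 7≤p k C v ((c , _ , v∈c) , ‖v‖≡2) =
  (λ i → Equivalence.to (InClass-zero⇔InA p (class≡0 i)) (v∈c i)) , ‖v‖≡2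
  where
  n d : Fin k → ℕ
  n i = toℕ (c i)
  d i = p ∸ n i
  n+d≡p : ∀ i → n i + d i ≡ p
  n+d≡p i = ℕP.m+[n∸m]≡n (ℕP.<⇒≤ (FinP.toℕ<n (c i)))
  coset-norms : ∀ i → Σ ℕ λ t → ι (+ p) ℚ.* sqnorm p (v i) ≡ ι (+ (n i * d i + p * t))
  coset-norms i = coset-norm p (c i) (d i) (n+d≡p i) (v i) (v∈c i)
  t : Fin k → ℕ
  t i = proj₁ (coset-norms i)
  nd≡0 : ∀ i → n i * d i ≡ 0
  nd≡0 = defects-vanish pr 7≤p k n d t n+d≡p
           (norm≡2⇒ℕsum≡2p p k v (λ i → n i * d i + p * t i) (proj₂ ∘ coset-norms) ‖v‖≡2)
  class≡0 : ∀ i → n i ≡ 0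
  class≡0 i =
    ℕP.m*n≡0⇒m≡0 (n i) (d i) {{ℕ.>-nonZero (ℕP.m<n⇒0<n∸m (FinP.toℕ<n (c i)))}} (nd≡0 i)

toℕ[0modp]≡0 : ∀ p .{{_ : NonZero p}} → toℕ (0 mod p) ≡ 0
toℕ[0modp]≡0 (suc _) = refl

R[2]⊆LA[2] : ∀ p .{{_ : NonZero p}} k (C : Word p k → Set) → IsCode p k C → ∀ v →
  InL2 p k (InR p k) v → InL2 p k (InLA p k C) v
R[2]⊆LA[2] p k C code v (v∈R , ‖v‖≡2) =
  (zeroWord p , IsCode.has-zero code , v∈zero-class) , ‖v‖≡2
  where
  v∈zero-class : ∀ i → InClass p (zeroWord p i) (v i)
  v∈zero-class i = Equivalence.from (InClass-zero⇔InA p (toℕ[0modp]≡0 p)) (v∈R i)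

lemma3p3 : (p : ℕ) .{{_ : NonZero p}} → Prime p → 7 ≤ p →
    (k : ℕ) (C : Word p k → Set) → IsCode p k C → SelfOrthogonal p k C →
    (∀ v → InL2 p k (InLA p k C) v → InL2 p k (InR p k) v) ×
    (∀ v → InL2 p k (InR p k) v → InL2 p k (InLA p k C) v)
lemma3p3 p pr 7≤p k C code _ = LA[2]⊆R[2] p pr 7≤p k C , R[2]⊆LA[2] p k C code
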